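{- For all integers $d>0$ we have $R_f(d)\le d^3-d^2+d$.
   Context: For an integer $n\ge 1$, ${\overset{\leftrightarrow}{K}}_n$ denotes the complete bidirected graph on $n$ vertices: for every pair of distinct vertices $u,v$ it has both directed edges $(u,v)$ and $(v,u)$. For an integer $d>0$ and $[d]=\{1,\dots,d\}$, a $d$-labeling of ${\overset{\leftrightarrow}{K}}_n$ assigns to every directed edge $e$ a function $\ell_e:[d]\to[d]$. A cycle means a simple directed cycle. If a cycle has edges $e_1,\dots,e_k$ in this order with labels $f_1,\dots,f_k$, it is a fixed-point cycle if the map $x\mapsto f_k(f_{k-1}(\cdots f_1(x)\cdots))$ has a fixed point in $[d]$. $R_f(d)$ is the largest $n$ such that there exists a $d$-labeling of ${\overset{\leftrightarrow}{K}}_n$ with no fixed-point cycle. -}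

module Defs where

open import Data.Nat using (ℕ; _≤_)
open import Data.Fin using (Fin)
open import Data.List using (List; []; _∷_; _++_; [_]; length)
open import Data.List.Relation.Unary.Unique.Propositional using (Unique)
open import Data.Product using (∃)
open import Relation.Binary.PropositionalEquality using (_≡_)
open import Relation.Nullary using (¬_)

-- A d-labeling of the complete bidirected graph on vertex set Fin n:
-- the directed edge (u , v) (u ≠ v) carries the function L u v : [d] → [d].
-- Diagonal values L u u are never used (cycles are simple, so no loops).
Labeling : ℕ → ℕ → Set
Labeling n d = Fin n → Fin n → Fin d → Fin d

pathMap : ∀ {n d} → Labeling n d → List (Fin n) → Fin d → Fin d
pathMap L []            x = x
pathMap L (v ∷ [])      x = x
pathMap L (v ∷ w ∷ vs)  x = pathMap L (w ∷ vs) (L v w x)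

-- A simple directed cycle: a list of k ≥ 2 pairwise distinct vertices
-- v₁,…,v_k, with edges (v₁,v₂),…,(v_{k-1},v_k),(v_k,v₁).
IsCycle : ∀ {n} → List (Fin n) → Set
IsCycle vs = Unique vs × 2 ≤ length vs
  where open import Data.Product using (_×_)

cycleMap : ∀ {n d} → Labeling n d → List (Fin n) → Fin d → Fin d
cycleMap L []       x = x
cycleMap L (v ∷ vs) x = pathMap L (v ∷ vs ++ [ v ]) x

FixedPointCycle : ∀ {n d} → Labeling n d → List (Fin n) → Set
FixedPointCycle L vs = ∃ λ x → cycleMap L vs x ≡ x

NoFixedPointCycle : ∀ {n d} → Labeling n d → Set
NoFixedPointCycle {n} L = (vs : List (Fin n)) → IsCycle vs → ¬ FixedPointCycle L vs

-- Fix a labeling with no fixed-point cycle. For a colouring σ : [n] → [d], call v a sink of σ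
-- if L v w (σ v) ≠ σ w for every w ≠ v. Every colouring has a sink: otherwise each v has an
-- out-neighbour s v with L v (s v) (σ v) = σ (s v), and a cycle of the map s is a cycle whose
-- label composite fixes σ at its first vertex. A colouring is determined by one of its sinks v,
-- the colour σ v, and the values σ w (w ≠ v), each avoiding L v w (σ v), so
-- d ^ n ≤ d · n · (d − 1) ^ (n − 1). A second-order binomial estimate shows that this fails
-- once n > d³ − d² + d.
module Submission where

open import Defs
open import Data.Nat
  using (ℕ; zero; suc; _+_; _*_; _^_; _∸_; _≤_; _<_; _≤?_; z≤n; s≤s; s≤s⁻¹; z<s; NonZero)
open import Data.Nat.Properties
  using ( ≤-refl; ≤-reflexive; ≤-trans; <-≤-trans; ≤-<-trans; n≮n; <⇒≱; ≰⇒>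
        ; +-assoc; +-identityʳ; *-zeroʳ; ^-zeroˡ; m^n≢0; m+n∸m≡n; m≤m+n; m≤m*n; m<n+m
        ; +-monoˡ-≤; +-monoʳ-≤; *-monoʳ-≤; +-monoʳ-<; *-monoʳ-<
        ; +-cancelʳ-≤; +-cancelʳ-<; *-cancelˡ-<
        ; module ≤-Reasoning )
open import Data.Nat.Tactic.RingSolver using (solve-∀)
open import Data.Fin using (Fin; zero; suc; combine; funToFin; finToFun; punchIn; punchOut)
open import Data.Fin.Properties
  using ( _≟_; any?; injective⇒≤; combine-injective; funToFin-finToFin; finToFun-funToFin
        ; punchInᵢ≢i; punchIn-punchOut; punchOut-injective )
open import Data.List using (List; []; _∷_; _++_; [_]; length; lookup)
open import Data.List.Properties using (length-++)
open import Data.List.Membership.Propositional using (_∈_; _∉_)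
open import Data.List.Membership.Propositional.Properties using (∈-lookup)
import Data.List.Membership.DecPropositional as DecMembership
open import Data.List.Relation.Unary.All as All using ([])
open import Data.List.Relation.Unary.Any using (here; there)
open import Data.List.Relation.Unary.AllPairs using ([]; _∷_)
open import Data.List.Relation.Unary.Unique.Propositional using (Unique)
import Data.List.Relation.Unary.Unique.Propositional.Properties as Unique
open import Data.Empty using (⊥)
open import Data.Product using (∃; _×_; _,_; proj₁; proj₂)
open import Data.Sum using (_⊎_; inj₁; inj₂)
open import Function using (_∘_)
open import Relation.Nullary using (Dec; yes; no; ¬?; _×-dec_; contradiction)
open import Relation.Nullary.Decidable using (decidable-stable)
open import Relation.Binary.PropositionalEquality hiding ([_])

-- (1 + 1/e) ^ k ≥ 1 + k/e + k(k − 1)/(2e²), cleared of denominators and of the subtraction.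
binomial-second-order : ∀ e k →
  e ^ k * (2 * e * e + 2 * k * e + k * k) ≤ 2 * e * e * suc e ^ k + k * e ^ k
binomial-second-order e zero = ≤-reflexive (base e)
  where
  base : ∀ e → 1 * (2 * e * e + 2 * 0 * e + 0 * 0) ≡ 2 * e * e * 1 + 0 * 1
  base = solve-∀
binomial-second-order e (suc k) = +-cancelʳ-≤ (E * k + (e + 1) * (k * E)) _ _ (begin
    e * E * S′ + (E * k + (e + 1) * (k * E))
      ≤⟨ +-monoʳ-≤ (e * E * S′) (+-monoˡ-≤ ((e + 1) * (k * E)) (*-monoʳ-≤ E (n≤n*n k))) ⟩
    e * E * S′ + (E * (k * k) + (e + 1) * (k * E))
      ≡⟨ expand e k E ⟩
    (e + 1) * (E * S) + (k + 1) * (e * E) + E * k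
      ≤⟨ +-monoˡ-≤ (E * k) (+-monoˡ-≤ ((k + 1) * (e * E))
           (*-monoʳ-≤ (e + 1) (binomial-second-order e k))) ⟩
    (e + 1) * (2 * e * e * P + k * E) + (k + 1) * (e * E) + E * k
      ≡⟨ regroup e k E P ⟩
    2 * e * e * (suc e * P) + suc k * (e * E) + (E * k + (e + 1) * (k * E)) ∎)
  where
  open ≤-Reasoning
  E = e ^ k
  P = suc e ^ k
  S = 2 * e * e + 2 * k * e + k * k
  S′ = 2 * e * e + 2 * suc k * e + suc k * suc k
  n≤n*n : ∀ n → n ≤ n * n
  n≤n*n zero    = z≤n
  n≤n*n (suc n) = m≤m*n (suc n) (suc n)
  expand : ∀ e k E →
             e * E * (2 * e * e + 2 * (1 + k) * e + (1 + k) * (1 + k)) + (E * (k * k) + (e + 1) * (k * E))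
                   ≡ (e + 1) * (E * (2 * e * e + 2 * k * e + k * k)) + (k + 1) * (e * E) + E * k
  expand = solve-∀
  regroup : ∀ e k E P → (e + 1) * (2 * e * e * P + k * E) + (k + 1) * (e * E) + E * k
                      ≡ 2 * e * e * ((1 + e) * P) + (1 + k) * (e * E) + (E * k + (e + 1) * (k * E))
  regroup = solve-∀

[1+k]*e^k<[1+e]^k : ∀ e k → 2 * e * e < k → suc k * e ^ k < suc e ^ k
[1+k]*e^k<[1+e]^k zero (suc k) _ = begin-strict
  suc (suc k) * 0 ≡⟨ *-zeroʳ (suc (suc k)) ⟩
  0               <⟨ z<s ⟩
  1               ≡⟨ ^-zeroˡ (suc k) ⟨
  1 ^ suc k       ∎
  where open ≤-Reasoning
[1+k]*e^k<[1+e]^k e@(suc _) k@(suc _) c<k =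
  *-cancelˡ-< c _ _ (+-cancelʳ-< (k * E) _ _ (begin-strict
    c * (suc k * E) + k * E             ≡⟨ regroup c k E ⟩
    E * (c + k * suc c)                 <⟨ *-monoʳ-< E (+-monoʳ-< c (*-monoʳ-< k 1+c<2e+k)) ⟩
    E * (c + k * (2 * e + k))           ≡⟨ cong (E *_) (expand e k) ⟩
    E * (2 * e * e + 2 * k * e + k * k) ≤⟨ binomial-second-order e k ⟩
    c * suc e ^ k + k * E               ∎))
  where
  open ≤-Reasoning
  c = 2 * e * e
  E = e ^ k
  1+c<2e+k : suc c < 2 * e + k
  1+c<2e+k = ≤-<-trans c<k (m<n+m k z<s)
  instance
    E≢0 : NonZero E
    E≢0 = m^n≢0 e k
  regroup : ∀ c k E → c * (suc k * E) + k * E ≡ E * (c + k * suc c)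
  regroup = solve-∀
  expand : ∀ e k → 2 * e * e + k * (2 * e + k) ≡ 2 * e * e + 2 * k * e + k * k
  expand = solve-∀

2e²<[1+e]³∸[1+e]²+[1+e] : ∀ e → 2 * e * e < suc e ^ 3 ∸ suc e ^ 2 + suc e
2e²<[1+e]³∸[1+e]²+[1+e] e = begin-strict
  2 * e * e                             <⟨ m≤m+n (suc (2 * e * e)) _ ⟩
  suc (2 * e * e) + (e * e * e + 2 * e) ≡⟨ expand e ⟨
  e * d ^ 2 + d                         ≡⟨ cong (_+ d) (m+n∸m≡n (d ^ 2) (e * d ^ 2)) ⟨
  d ^ 2 + e * d ^ 2 ∸ d ^ 2 + d         ≡⟨ cong (λ x → x ∸ d ^ 2 + d) (cube e) ⟨
  d ^ 3 ∸ d ^ 2 + d                     ∎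
  where
  open ≤-Reasoning
  d = suc e
  cube : ∀ e → suc e * (suc e * (suc e * 1)) ≡ suc e * (suc e * 1) + e * (suc e * (suc e * 1))
  cube = solve-∀
  expand : ∀ e → e * (suc e * (suc e * 1)) + suc e ≡ suc (2 * e * e) + (e * e * e + 2 * e)
  expand = solve-∀

funToFin-cong : ∀ {m a} {f g : Fin m → Fin a} → f ≗ g → funToFin f ≡ funToFin g
funToFin-cong {zero}  f≗g = refl
funToFin-cong {suc m} f≗g = cong₂ combine (f≗g zero) (funToFin-cong (f≗g ∘ suc))

^≤-by-injection : ∀ {m a N} (f : (Fin m → Fin a) → Fin N) →
                  (∀ σ τ → f σ ≡ f τ → σ ≗ τ) → a ^ m ≤ N
^≤-by-injection {m} {a} f f-inj = injective⇒≤ {f = f ∘ finToFun {a} {m}} λ {i} {j} eq → begin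
  i                             ≡⟨ funToFin-finToFin {m} {a} i ⟨
  funToFin (finToFun {a} {m} i) ≡⟨ funToFin-cong (f-inj _ _ eq) ⟩
  funToFin (finToFun {a} {m} j) ≡⟨ funToFin-finToFin {m} {a} j ⟩
  j                             ∎
  where open ≡-Reasoning

punchOut-injective′ : ∀ {n} {i i′ j j′ : Fin (suc n)} (i≢j : i ≢ j) (i′≢j′ : i′ ≢ j′) →
                      i ≡ i′ → punchOut i≢j ≡ punchOut i′≢j′ → j ≡ j′
punchOut-injective′ i≢j i′≢j′ refl = punchOut-injective i≢j i′≢j′

lookup-injective : ∀ {n} {xs : List (Fin n)} → Unique xs → ∀ i j → lookup xs i ≡ lookup xs j → i ≡ j
lookup-injective (_ ∷ _)   zero    zero    _  = refl
lookup-injective (x∉ ∷ _)  zero    (suc j) eq = contradiction eq (All.lookup x∉ (∈-lookup j))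
lookup-injective (x∉ ∷ _)  (suc i) zero    eq = contradiction (sym eq) (All.lookup x∉ (∈-lookup i))
lookup-injective (_ ∷ uxs) (suc i) (suc j) eq = cong suc (lookup-injective uxs i j eq)

Unique⇒length≤ : ∀ {n} {xs : List (Fin n)} → Unique xs → length xs ≤ n
Unique⇒length≤ uxs = injective⇒≤ (lookup-injective uxs _ _)

Unique-∷ʳ : ∀ {A : Set} {xs : List A} {y} → Unique xs → y ∉ xs → Unique (xs ++ [ y ])
Unique-∷ʳ uxs y∉ = Unique.++⁺ uxs ([] ∷ []) λ { (y∈ , here refl) → y∉ y∈ }

module FunctionalGraph {n} (s : Fin n → Fin n) where

  open DecMembership (_≟_ {n}) using (_∈?_)

  data Orbit : Fin n → List (Fin n) → Fin n → Set where
    stop : ∀ {a} → Orbit a [] a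
    next : ∀ {a ws c} → Orbit (s a) ws c → Orbit a (s a ∷ ws) c

  ClosedOrbit : List (Fin n) → Set
  ClosedOrbit []       = ⊥
  ClosedOrbit (t ∷ ws) = Orbit t (ws ++ [ t ]) t

  orbit-∷ʳ : ∀ {a ws c} → Orbit a ws c → Orbit a (ws ++ [ s c ]) (s c)
  orbit-∷ʳ stop     = next stop
  orbit-∷ʳ (next o) = next (orbit-∷ʳ o)

  orbit-from : ∀ {a ws c t} → Orbit a ws c → Unique (a ∷ ws) → t ∈ a ∷ ws →
               ∃ λ vs → Orbit t vs c × Unique (t ∷ vs)
  orbit-from o        u       (here refl) = _ , o , u
  orbit-from (next o) (_ ∷ u) (there t∈)  = orbit-from o u t∈

  orbit-step : ∀ {a b c} → Orbit a [ b ] c → s a ≡ b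
  orbit-step (next stop) = refl

  -- Follow s from a until it re-enters the orbit; this happens within n steps.
  simple-closed-orbit : Fin n → ∃ λ vs → Unique vs × ClosedOrbit vs
  simple-closed-orbit a = extend n stop ([] ∷ []) ≤-refl
    where
    extend : ∀ fuel {ws c} → Orbit a ws c → Unique (a ∷ ws) → n ≤ length ws + fuel →
             ∃ λ vs → Unique vs × ClosedOrbit vs
    extend zero o u n≤ =
      contradiction (≤-trans (Unique⇒length≤ u) (≤-trans n≤ (≤-reflexive (+-identityʳ _)))) (n≮n _)
    extend (suc fuel) {ws} {c} o u n≤ with s c ∈? a ∷ ws
    ... | yes sc∈ with vs , o′ , u′ ← orbit-from o u sc∈ = s c ∷ vs , u′ , orbit-∷ʳ o′
    ... | no  sc∉ = extend fuel (orbit-∷ʳ o) (Unique-∷ʳ u sc∉) (subst (n ≤_) length-grows n≤)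
      where
      length-grows : length ws + suc fuel ≡ length (ws ++ [ s c ]) + fuel
      length-grows = sym (trans (cong (_+ fuel) (length-++ ws)) (+-assoc (length ws) 1 fuel))

  closed-orbit-length : (∀ v → s v ≢ v) → ∀ {vs} → ClosedOrbit vs → 2 ≤ length vs
  closed-orbit-length s≢ {t ∷ []}    o = contradiction (orbit-step o) (s≢ t)
  closed-orbit-length s≢ {_ ∷ _ ∷ _} o = s≤s (s≤s z≤n)

  module _ {d} (L : Labeling n d) (σ : Fin n → Fin d)
           (along-s : ∀ v → L v (s v) (σ v) ≡ σ (s v)) where

    orbit-pathMap : ∀ {a ws c} → Orbit a ws c → pathMap L (a ∷ ws) (σ a) ≡ σ c
    orbit-pathMap stop                   = refl
    orbit-pathMap {a} (next {ws = ws} o) =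
      trans (cong (pathMap L (s a ∷ ws)) (along-s a)) (orbit-pathMap o)

    closed-orbit-fixedPoint : ∀ {vs} → ClosedOrbit vs → FixedPointCycle L vs
    closed-orbit-fixedPoint {t ∷ _} o = σ t , orbit-pathMap o

Sink : ∀ {n d} → Labeling n d → (Fin n → Fin d) → Fin n → Set
Sink L σ v = ∀ w → w ≢ v → L v w (σ v) ≢ σ w

module _ {n d} (L : Labeling n d) (σ : Fin n → Fin d) where

  Successor : Fin n → Fin n → Set
  Successor v w = w ≢ v × L v w (σ v) ≡ σ w

  successor? : ∀ v → Dec (∃ (Successor v))
  successor? v = any? λ w → ¬? (w ≟ v) ×-dec (L v w (σ v) ≟ σ w)

  sink-or-successors : ∃ (Sink L σ) ⊎ (∀ v → ∃ (Successor v))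
  sink-or-successors with any? (¬? ∘ successor?)
  ... | yes (v , no-successor) = inj₁ (v , λ w w≢v eq → no-successor (w , w≢v , eq))
  ... | no  no-sink            = inj₂ λ v → decidable-stable (successor? v) (no-sink ∘ (v ,_))

  successors⇒fixedPointCycle : (∀ v → ∃ (Successor v)) → Fin n →
                               ∃ λ vs → IsCycle vs × FixedPointCycle L vs
  successors⇒fixedPointCycle succ a =
    let vs , unique , closed = simple-closed-orbit a
    in  vs , (unique , closed-orbit-length (proj₁ ∘ proj₂ ∘ succ) closed)
           , closed-orbit-fixedPoint L σ (proj₂ ∘ proj₂ ∘ succ) closed
    where open FunctionalGraph (proj₁ ∘ succ)

sinks-exist : ∀ {k d} (L : Labeling (suc k) d) → NoFixedPointCycle L → ∀ σ → ∃ (Sink L σ)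
sinks-exist L no-fp σ with sink-or-successors L σ
... | inj₁ sink = sink
... | inj₂ succ with vs , cycle , fp ← successors⇒fixedPointCycle L σ succ zero =
  contradiction fp (no-fp vs cycle)

module _ {k e} (L : Labeling (suc k) (suc e)) where

  residue : ∀ {σ v} → Sink L σ v → Fin k → Fin e
  residue {v = v} sink j = punchOut (sink (punchIn v j) (punchInᵢ≢i v j))

  sink-determines : ∀ {σ τ v} (σ-sink : Sink L σ v) (τ-sink : Sink L τ v) →
                    σ v ≡ τ v → residue σ-sink ≗ residue τ-sink → σ ≗ τ
  sink-determines {σ} {τ} {v} σ-sink τ-sink σv≡τv res≡ w with w ≟ v
  ... | yes refl = σv≡τv
  ... | no  w≢v  = begin
    σ w             ≡⟨ cong σ (punchIn-punchOut v≢w) ⟨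
    σ (punchIn v j) ≡⟨ punchOut-injective′ _ _ (cong (L v (punchIn v j)) σv≡τv) (res≡ j) ⟩
    τ (punchIn v j) ≡⟨ cong τ (punchIn-punchOut v≢w) ⟩
    τ w             ∎
    where
    open ≡-Reasoning
    v≢w = w≢v ∘ sym
    j = punchOut v≢w

  encode : ∀ {σ} → ∃ (Sink L σ) → Fin (suc e * (suc k * e ^ k))
  encode {σ} (v , sink) = combine (σ v) (combine v (funToFin (residue sink)))

  encode-injective : ∀ {σ τ} (p : ∃ (Sink L σ)) (q : ∃ (Sink L τ)) → encode p ≡ encode q → σ ≗ τ
  encode-injective {σ} {τ} (v , σ-sink) (v′ , τ-sink) eq
    with combine-injective (σ v) _ (τ v′) _ eq
  ... | σv≡τv , eq′
    with combine-injective v (funToFin (residue σ-sink)) v′ (funToFin (residue τ-sink)) eq′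
  ... | refl , res≡ = sink-determines σ-sink τ-sink σv≡τv λ j → begin
    residue σ-sink j                       ≡⟨ finToFun-funToFin (residue σ-sink) j ⟨
    finToFun (funToFin (residue σ-sink)) j ≡⟨ cong (λ t → finToFun t j) res≡ ⟩
    finToFun (funToFin (residue τ-sink)) j ≡⟨ finToFun-funToFin (residue τ-sink) j ⟩
    residue τ-sink j                       ∎
    where open ≡-Reasoning

  sinks⇒^≤ : (∀ σ → ∃ (Sink L σ)) → suc e ^ suc k ≤ suc e * (suc k * e ^ k)
  sinks⇒^≤ sink = ^≤-by-injection (encode ∘ sink) (λ σ τ → encode-injective (sink σ) (sink τ))

lemma6 : (d : ℕ) → 0 < d → (n : ℕ) → (L : Labeling n d) →
         NoFixedPointCycle L → n ≤ d ^ 3 ∸ d ^ 2 + d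
lemma6 d       _ zero    L no-fp = z≤n
lemma6 (suc e) _ (suc k) L no-fp with suc k ≤? suc e ^ 3 ∸ suc e ^ 2 + suc e
... | yes n≤bound = n≤bound
... | no  n≰bound = contradiction (sinks⇒^≤ L (sinks-exist L no-fp)) (<⇒≱ too-few-colourings)
  where
  2e²<k : 2 * e * e < k
  2e²<k = <-≤-trans (2e²<[1+e]³∸[1+e]²+[1+e] e) (s≤s⁻¹ (≰⇒> n≰bound))
  too-few-colourings : suc e * (suc k * e ^ k) < suc e ^ suc k
  too-few-colourings = *-monoʳ-< (suc e) ([1+k]*e^k<[1+e]^k e k 2e²<k)
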